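{- Let $(j_n)_{n\ge 0}$ be defined by $j_0=0$ and $j_n=\left(\frac{ -1}{n}\right)$ (the Jacobi–Kronecker symbol) for $n\ge 1$; equivalently $j_0=0$, $j_{2k}=j_k$ and $j_{2k+1}=(-1)^k$ for all $k\ge 0$. Let $s_n=1+\sum_{0\le k\le n} j_k$ for $n\ge 0$. Then for every integer $m$ and every $n\ge 0$, $s_n=m$ if and only if the base-$2$ representation of $n$ has exactly $m-1$ runs (the representation of $0$ is taken to be empty, with $0$ runs). Furthermore, for every $N\ge 0$, the set of values $\{s_0,s_1,\ldots,s_{2^N-1}\}$ is $\{1,2,\ldots,N+1\}$.
   Context: A run in a word is a maximal block of consecutive identical letters. The base-$2$ representation of a positive integer is its standard binary expansion without leading zeros. -}

module Defs where

open import Data.Nat using (ℕ; zero; suc; _+_; _%_; _/_)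
open import Data.Nat.DivMod
open import Data.Integer using (ℤ; +_; -_) renaming (_+_ to _+ℤ_)
open import Data.Bool using (Bool; true; false; if_then_else_)
open import Data.List using (List; []; _∷_; reverse)

negOnePow : ℕ → ℤ
negOnePow zero = + 1
negOnePow (suc k) = - negOnePow k

-- j with fuel: j₀ = 0, j_{2k} = j_k, j_{2k+1} = (-1)^k.
-- Fuel n suffices for the argument n (each step halves a positive argument).
jFuel : ℕ → ℕ → ℤ
jFuel _ zero = + 0
jFuel zero (suc _) = + 0
jFuel (suc f) (suc n) with (suc n) % 2
... | zero = jFuel f ((suc n) / 2)
... | suc _ = negOnePow ((suc n) / 2)

j : ℕ → ℤ
j n = jFuel n n

sumJ : ℕ → ℤ
sumJ zero = j zero
sumJ (suc n) = sumJ n +ℤ j (suc n)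

s : ℕ → ℤ
s n = + 1 +ℤ sumJ n

bitsFuel : ℕ → ℕ → List Bool
bitsFuel _ zero = []
bitsFuel zero (suc _) = []
bitsFuel (suc f) (suc n) with (suc n) % 2
... | zero = false ∷ bitsFuel f ((suc n) / 2)
... | suc _ = true ∷ bitsFuel f ((suc n) / 2)

binary : ℕ → List Bool
binary n = reverse (bitsFuel n n)

sameBit : Bool → Bool → Bool
sameBit true true = true
sameBit false false = true
sameBit _ _ = false

runs : List Bool → ℕ
runs [] = 0
runs (x ∷ []) = 1
runs (x ∷ y ∷ w) = (if sameBit x y then 0 else 1) + runs (y ∷ w)

-- Appending a bit b to the binary expansion of m (giving 2m + b) changes both
-- Σ_{k ≤ n} j_k and the number of runs in the same way: each grows by 1 exactly
-- when b differs from the last bit of m, and is unchanged otherwise. For the sum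
-- this is because the terms of index ≤ 2m + b split into the even-indexed ones,
-- j_{2k} = j_k for k ≤ m, and the odd-indexed ones, (-1)^i, whose partial sums
-- are 1 or 0 according to the parity of m. Hence s_n = 1 + runs (binary n).
-- A number below 2^N has at most N binary digits, hence at most N runs, and the
-- alternating words 1, 10, 101, 1010, ... realise every run count.

module Submission where

open import Data.Bool using (Bool; true; false; not; if_then_else_)
open import Data.Bool.Properties using (not-involutive)
open import Data.Integer using (ℤ; +_; -[1+_]; _-_; +≤+) renaming (_+_ to _+ℤ_; _≤_ to _≤ℤ_)
open import Data.Integer.Properties as ℤ using ()
open import Algebra.Properties.CommutativeSemigroup ℤ.+-commutativeSemigroup using (xy∙z≈xz∙y)
open import Data.List using (List; _∷_; []; reverse; _∷ʳ_)
open import Data.List.Properties using (unfold-reverse)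
open import Data.Nat
open import Data.Nat.DivMod
open import Data.Nat.Induction using (<-rec)
open import Data.Nat.Properties
open import Data.Product using (Σ; ∃; ∃₂; _×_; _,_)
open import Defs
open import Function.Base using (_∘_)
open import Function.Bundles using (_⇔_; mk⇔)
open import Relation.Binary.PropositionalEquality

appendBit : Bool → ℕ → ℕ
appendBit false m = m + m
appendBit true  m = suc (m + m)

appendBit-surjective : ∀ n → ∃₂ λ b m → appendBit b m ≡ n
appendBit-surjective zero = false , 0 , refl
appendBit-surjective (suc n) with appendBit-surjective n
... | false , m , refl = true , m , refl
... | true  , m , refl = false , suc m , cong suc (+-suc m m)

binaryInduction : ∀ {ℓ} (P : ℕ → Set ℓ) → P 0 → (∀ b m → P m → P (appendBit b m)) → ∀ n → P n
binaryInduction P base step = <-rec P go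
  where
  halving : ∀ b m → suc m < appendBit b (suc m)
  halving false m = m<m+n (suc m) z<s
  halving true  m = m<n⇒m<1+n (m<m+n (suc m) z<s)

  go : ∀ n → (∀ {k} → k < n → P k) → P n
  go n ih with appendBit-surjective n
  ... | b , zero  , refl = step b 0 base
  ... | b , suc m , refl = step b (suc m) (ih (halving b m))

bitValue : Bool → ℕ
bitValue false = 0
bitValue true  = 1

appendBit-suc : ∀ b m → appendBit b (suc m) ≡ 2 + appendBit b m
appendBit-suc false m = cong suc (+-suc m m)
appendBit-suc true  m = cong (λ k → 2 + k) (+-suc m m)

appendBit-%2 : ∀ b m → appendBit b m % 2 ≡ bitValue b
appendBit-%2 false zero    = refl
appendBit-%2 true  zero    = refl
-- (2 + n) % 2 and n % 2 are definitionally equal.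
appendBit-%2 b     (suc m) rewrite appendBit-suc b m = appendBit-%2 b m

appendBit-/2 : ∀ b m → appendBit b m / 2 ≡ m
appendBit-/2 false zero    = refl
appendBit-/2 true  zero    = refl
appendBit-/2 b     (suc m) rewrite appendBit-suc b m =
  trans (m/n≡1+[m∸n]/n {2 + appendBit b m} (s≤s (s≤s z≤n))) (cong suc (appendBit-/2 b m))

suc-/2-≤ : ∀ n → suc n / 2 ≤ n
suc-/2-≤ n = s≤s⁻¹ (m/n<m (suc n) 2 (s≤s (s≤s z≤n)))

jFuel-fuel : ∀ {f g} n → n ≤ f → n ≤ g → jFuel f n ≡ jFuel g n
jFuel-fuel zero _ _ = refl
jFuel-fuel {suc f} {suc g} (suc n) (s≤s n≤f) (s≤s n≤g) with suc n % 2
... | zero  = jFuel-fuel (suc n / 2) (≤-trans (suc-/2-≤ n) n≤f) (≤-trans (suc-/2-≤ n) n≤g)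
... | suc _ = refl

bitsFuel-fuel : ∀ {f g} n → n ≤ f → n ≤ g → bitsFuel f n ≡ bitsFuel g n
bitsFuel-fuel zero _ _ = refl
bitsFuel-fuel {suc f} {suc g} (suc n) (s≤s n≤f) (s≤s n≤g) with suc n % 2
... | zero  = cong (false ∷_) (bitsFuel-fuel (suc n / 2) (≤-trans (suc-/2-≤ n) n≤f) (≤-trans (suc-/2-≤ n) n≤g))
... | suc _ = cong (true ∷_) (bitsFuel-fuel (suc n / 2) (≤-trans (suc-/2-≤ n) n≤f) (≤-trans (suc-/2-≤ n) n≤g))

jFuel-odd : ∀ {f} n → suc n % 2 ≡ 1 → jFuel (suc f) (suc n) ≡ negOnePow (suc n / 2)
jFuel-odd n eq rewrite eq = refl

jFuel-even : ∀ {f} n → suc n % 2 ≡ 0 → jFuel (suc f) (suc n) ≡ jFuel f (suc n / 2)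
jFuel-even n eq rewrite eq = refl

bitsFuel-suc : ∀ {f} n b → suc n % 2 ≡ bitValue b → bitsFuel (suc f) (suc n) ≡ b ∷ bitsFuel f (suc n / 2)
bitsFuel-suc n false eq rewrite eq = refl
bitsFuel-suc n true  eq rewrite eq = refl

j-odd : ∀ m → j (appendBit true m) ≡ negOnePow m
j-odd m = trans (jFuel-odd (m + m) (appendBit-%2 true m)) (cong negOnePow (appendBit-/2 true m))

j-even : ∀ m → j (appendBit false (suc m)) ≡ j (suc m)
j-even m = begin
  jFuel (suc n) (suc n)  ≡⟨ jFuel-even n (appendBit-%2 false (suc m)) ⟩
  jFuel n (suc n / 2)    ≡⟨ cong (jFuel n) (appendBit-/2 false (suc m)) ⟩
  jFuel n (suc m)        ≡⟨ jFuel-fuel (suc m) (m≤n+m (suc m) m) ≤-refl ⟩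
  j (suc m)              ∎
  where
  open ≡-Reasoning
  n = m + suc m

bits : ℕ → List Bool
bits n = bitsFuel n n

bits-suc : ∀ {n m} b → suc n % 2 ≡ bitValue b → suc n / 2 ≡ m → bits (suc n) ≡ b ∷ bits m
bits-suc {n} b %2≡b refl =
  trans (bitsFuel-suc n b %2≡b) (cong (b ∷_) (bitsFuel-fuel (suc n / 2) (suc-/2-≤ n) ≤-refl))

bits-odd : ∀ m → bits (appendBit true m) ≡ true ∷ bits m
bits-odd m = bits-suc true (appendBit-%2 true m) (appendBit-/2 true m)

bits-even : ∀ m → bits (appendBit false (suc m)) ≡ false ∷ bits (suc m)
bits-even m = bits-suc false (appendBit-%2 false (suc m)) (appendBit-/2 false (suc m))

lastBit : ℕ → Bool
lastBit zero    = false
lastBit (suc n) = not (lastBit n)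

lastBit-appendBit : ∀ b m → lastBit (appendBit b m) ≡ b
lastBit-appendBit false zero    = refl
lastBit-appendBit true  zero    = refl
lastBit-appendBit b     (suc m) rewrite appendBit-suc b m =
  trans (not-involutive (lastBit (appendBit b m))) (lastBit-appendBit b m)

bits-head : ∀ n → ∃ λ t → bits (suc n) ≡ lastBit (suc n) ∷ t
bits-head n with appendBit-surjective (suc n)
... | true  , m     , refl rewrite lastBit-appendBit true m = bits m , bits-odd m
... | false , suc m , refl rewrite lastBit-appendBit false (suc m) = bits (suc m) , bits-even m

boundary : Bool → Bool → ℕ
boundary a b = if sameBit a b then 0 else 1

runs-∷ʳ : ∀ w a b → runs (w ∷ʳ a ∷ʳ b) ≡ runs (w ∷ʳ a) + boundary a b
runs-∷ʳ []          a b = +-comm (boundary a b) 1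
runs-∷ʳ (x ∷ [])     a b = begin
  boundary x a + (boundary a b + 1)  ≡⟨ cong (λ k → boundary x a + k) (+-comm (boundary a b) 1) ⟩
  boundary x a + (1 + boundary a b)  ≡⟨ +-assoc (boundary x a) 1 (boundary a b) ⟨
  boundary x a + 1 + boundary a b    ∎
  where open ≡-Reasoning
runs-∷ʳ (x ∷ y ∷ w) a b =
  trans (cong (λ k → boundary x y + k) (runs-∷ʳ (y ∷ w) a b)) (sym (+-assoc (boundary x y) _ _))

runs-reverse-∷ : ∀ b a t → runs (reverse (b ∷ a ∷ t)) ≡ runs (reverse (a ∷ t)) + boundary a b
runs-reverse-∷ b a t rewrite unfold-reverse b (a ∷ t) | unfold-reverse a t = runs-∷ʳ (reverse t) a b

runs-binary-appendBit : ∀ b m → runs (binary (appendBit b m)) ≡ runs (binary m) + boundary (lastBit m) b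
runs-binary-appendBit false zero    = refl
runs-binary-appendBit true  zero    = refl
runs-binary-appendBit b     (suc m) with bits-head m
... | t , bits≡ = begin
  runs (reverse (bits (appendBit b (suc m))))       ≡⟨ cong (runs ∘ reverse) (bits-appendBit b m) ⟩
  runs (reverse (b ∷ bits (suc m)))                 ≡⟨ cong (λ w → runs (reverse (b ∷ w))) bits≡ ⟩
  runs (reverse (b ∷ lastBit (suc m) ∷ t))          ≡⟨ runs-reverse-∷ b (lastBit (suc m)) t ⟩
  runs (reverse (lastBit (suc m) ∷ t)) + boundary (lastBit (suc m)) b
    ≡⟨ cong (λ w → runs (reverse w) + boundary (lastBit (suc m)) b) bits≡ ⟨
  runs (reverse (bits (suc m))) + boundary (lastBit (suc m)) b  ∎
  where
  open ≡-Reasoning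
  bits-appendBit : ∀ b m → bits (appendBit b (suc m)) ≡ b ∷ bits (suc m)
  bits-appendBit false m = bits-even m
  bits-appendBit true  m = bits-odd (suc m)

negOnePow-lastBit : ∀ m → negOnePow m ≡ (if lastBit m then -[1+ 0 ] else + 1)
negOnePow-lastBit zero = refl
negOnePow-lastBit (suc m) rewrite negOnePow-lastBit m with lastBit m
... | false = refl
... | true  = refl

boundary-false+negOnePow : ∀ m → + boundary (lastBit m) false +ℤ negOnePow m ≡ + boundary (lastBit m) true
boundary-false+negOnePow m rewrite negOnePow-lastBit m with lastBit m
... | false = refl
... | true  = refl

boundary-not : ∀ x → boundary (not x) false ≡ boundary x true
boundary-not false = refl
boundary-not true  = refl

sumJ-odd  : ∀ m → sumJ (appendBit true m)  ≡ sumJ m +ℤ + boundary (lastBit m) true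
sumJ-even : ∀ m → sumJ (appendBit false m) ≡ sumJ m +ℤ + boundary (lastBit m) false

sumJ-odd m = begin
  sumJ (m + m) +ℤ j (appendBit true m)                      ≡⟨ cong₂ _+ℤ_ (sumJ-even m) (j-odd m) ⟩
  sumJ m +ℤ + boundary (lastBit m) false +ℤ negOnePow m     ≡⟨ ℤ.+-assoc (sumJ m) _ _ ⟩
  sumJ m +ℤ (+ boundary (lastBit m) false +ℤ negOnePow m)   ≡⟨ cong (sumJ m +ℤ_) (boundary-false+negOnePow m) ⟩
  sumJ m +ℤ + boundary (lastBit m) true                     ∎
  where open ≡-Reasoning

sumJ-even zero    = refl
sumJ-even (suc m) = begin
  sumJ (m + suc m) +ℤ j (appendBit false (suc m))
    ≡⟨ cong₂ _+ℤ_ (cong sumJ (+-suc m m)) (j-even m) ⟩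
  sumJ (appendBit true m) +ℤ j (suc m)
    ≡⟨ cong (_+ℤ j (suc m)) (sumJ-odd m) ⟩
  sumJ m +ℤ + boundary (lastBit m) true +ℤ j (suc m)
    ≡⟨ xy∙z≈xz∙y (sumJ m) _ _ ⟩
  sumJ (suc m) +ℤ + boundary (lastBit m) true
    ≡⟨ cong (λ k → sumJ (suc m) +ℤ + k) (boundary-not (lastBit m)) ⟨
  sumJ (suc m) +ℤ + boundary (lastBit (suc m)) false  ∎
  where open ≡-Reasoning

sumJ-appendBit : ∀ b m → sumJ (appendBit b m) ≡ sumJ m +ℤ + boundary (lastBit m) b
sumJ-appendBit false = sumJ-even
sumJ-appendBit true  = sumJ-odd

sumJ≡runs : ∀ n → sumJ n ≡ + runs (binary n)
sumJ≡runs = binaryInduction (λ n → sumJ n ≡ + runs (binary n)) refl step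
  where
  step : ∀ b m → sumJ m ≡ + runs (binary m) → sumJ (appendBit b m) ≡ + runs (binary (appendBit b m))
  step b m ih = begin
    sumJ (appendBit b m)                                      ≡⟨ sumJ-appendBit b m ⟩
    sumJ m +ℤ + boundary (lastBit m) b                        ≡⟨ cong (_+ℤ + boundary (lastBit m) b) ih ⟩
    + (runs (binary m) + boundary (lastBit m) b)              ≡⟨ cong +_ (runs-binary-appendBit b m) ⟨
    + runs (binary (appendBit b m))                           ∎
    where open ≡-Reasoning

s≡1+runs : ∀ n → s n ≡ + suc (runs (binary n))
s≡1+runs n = cong (+ 1 +ℤ_) (sumJ≡runs n)

boundary≤1 : ∀ a b → boundary a b ≤ 1
boundary≤1 false false = z≤n
boundary≤1 false true  = ≤-refl
boundary≤1 true  false = ≤-refl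
boundary≤1 true  true  = z≤n

boundary-not-≡1 : ∀ a → boundary a (not a) ≡ 1
boundary-not-≡1 false = refl
boundary-not-≡1 true  = refl

m+m≡2*m : ∀ m → m + m ≡ 2 * m
m+m≡2*m m = cong (λ k → m + k) (sym (+-identityʳ m))

appendBit-<-2* : ∀ b {m p} → m < p → appendBit b m < 2 * p
appendBit-<-2* b {m} {p} m<p = begin-strict
  appendBit b m          ≤⟨ appendBit≤1+2m b ⟩
  suc (m + m)            <⟨ n<1+n (suc (m + m)) ⟩
  2 + (m + m)            ≡⟨ appendBit-suc false m ⟨
  suc m + suc m          ≤⟨ +-mono-≤ m<p m<p ⟩
  p + p                  ≡⟨ m+m≡2*m p ⟩
  2 * p                  ∎
  where
  open ≤-Reasoning
  appendBit≤1+2m : ∀ b → appendBit b m ≤ suc (m + m)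
  appendBit≤1+2m false = n≤1+n (m + m)
  appendBit≤1+2m true  = ≤-refl

appendBit-<-2*⁻¹ : ∀ b {m p} → appendBit b m < 2 * p → m < p
appendBit-<-2*⁻¹ b {m} {p} lt = ≰⇒> λ p≤m → <⇒≱ lt (begin
  2 * p          ≤⟨ *-monoʳ-≤ 2 p≤m ⟩
  2 * m          ≡⟨ m+m≡2*m m ⟨
  m + m          ≤⟨ 2m≤appendBit b ⟩
  appendBit b m  ∎)
  where
  open ≤-Reasoning
  2m≤appendBit : ∀ b → m + m ≤ appendBit b m
  2m≤appendBit false = ≤-refl
  2m≤appendBit true  = n≤1+n (m + m)

runs-binary-appendBit-≤ : ∀ b m → runs (binary (appendBit b m)) ≤ suc (runs (binary m))
runs-binary-appendBit-≤ b m = begin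
  runs (binary (appendBit b m))                   ≡⟨ runs-binary-appendBit b m ⟩
  runs (binary m) + boundary (lastBit m) b        ≤⟨ +-monoʳ-≤ (runs (binary m)) (boundary≤1 (lastBit m) b) ⟩
  runs (binary m) + 1                             ≡⟨ +-comm (runs (binary m)) 1 ⟩
  suc (runs (binary m))                           ∎
  where open ≤-Reasoning

runs-binary-≤ : ∀ n N → n < 2 ^ N → runs (binary n) ≤ N
runs-binary-≤ = binaryInduction (λ n → ∀ N → n < 2 ^ N → runs (binary n) ≤ N) (λ _ _ → z≤n) step
  where
  step : ∀ b m → (∀ N → m < 2 ^ N → runs (binary m) ≤ N) →
         ∀ N → appendBit b m < 2 ^ N → runs (binary (appendBit b m)) ≤ N
  step b m ih zero    lt rewrite n<1⇒n≡0 lt = z≤n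
  step b m ih (suc N) lt =
    ≤-trans (runs-binary-appendBit-≤ b m) (s≤s (ih N (appendBit-<-2*⁻¹ b lt)))

alternating : ℕ → ℕ
alternating zero    = 0
alternating (suc r) = appendBit (not (lastBit (alternating r))) (alternating r)

runs-binary-alternating : ∀ r → runs (binary (alternating r)) ≡ r
runs-binary-alternating zero    = refl
runs-binary-alternating (suc r) = begin
  runs (binary (appendBit (not x) a))  ≡⟨ runs-binary-appendBit (not x) a ⟩
  runs (binary a) + boundary x (not x) ≡⟨ cong₂ _+_ (runs-binary-alternating r) (boundary-not-≡1 x) ⟩
  r + 1                                ≡⟨ +-comm r 1 ⟩
  suc r                                ∎
  where
  open ≡-Reasoning
  a = alternating r
  x = lastBit a

alternating-< : ∀ r → alternating r < 2 ^ r
alternating-< zero    = s≤s z≤n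
alternating-< (suc r) = appendBit-<-2* (not (lastBit (alternating r))) (alternating-< r)

+suc≡⇔≡-1 : ∀ r z → (+ suc r ≡ z) ⇔ (+ r ≡ z - + 1)
+suc≡⇔≡-1 r z = mk⇔ to from
  where
  to : ∀ {z} → + suc r ≡ z → + r ≡ z - + 1
  to refl = refl
  from : ∀ {z} → + r ≡ z - + 1 → + suc r ≡ z
  from {+ suc _} refl = refl
  from {+ zero} ()
  from { -[1+ _ ]} ()

theorem2 : ((m : ℤ) → (n : ℕ) → (s n ≡ m) ⇔ (+ runs (binary n) ≡ m - + 1))
    × ((N : ℕ) → (v : ℤ) →
    (Σ ℕ (λ k → (k < 2 ^ N) × (s k ≡ v))) ⇔ ((+ 1 ≤ℤ v) × (v ≤ℤ + (N Data.Nat.+ 1))))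
theorem2 = value-by-runs , λ N v → mk⇔ (values-≤ N) (values-≥ N)
  where
  value-by-runs : ∀ m n → (s n ≡ m) ⇔ (+ runs (binary n) ≡ m - + 1)
  value-by-runs m n rewrite s≡1+runs n = +suc≡⇔≡-1 (runs (binary n)) m

  values-≤ : ∀ N {v} → (Σ ℕ λ k → (k < 2 ^ N) × (s k ≡ v)) → (+ 1 ≤ℤ v) × (v ≤ℤ + (N + 1))
  values-≤ N (k , k<2^N , refl) rewrite s≡1+runs k =
    +≤+ (s≤s z≤n) , +≤+ (≤-trans (s≤s (runs-binary-≤ k N k<2^N)) (≤-reflexive (+-comm 1 N)))

  values-≥ : ∀ N {v} → (+ 1 ≤ℤ v) × (v ≤ℤ + (N + 1)) → Σ ℕ λ k → (k < 2 ^ N) × (s k ≡ v)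
  values-≥ N (+≤+ {n = suc r} _ , +≤+ r<N+1) =
    alternating r ,
    <-≤-trans (alternating-< r) (^-monoʳ-≤ 2 (s≤s⁻¹ (≤-trans r<N+1 (≤-reflexive (+-comm N 1))))) ,
    trans (s≡1+runs (alternating r)) (cong (λ x → + suc x) (runs-binary-alternating r))
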